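{- For $r\ge 5$, the generalised dodecahedron $D_r$ satisfies $\chi_i(D_r)=4$ if and only if $r\not\equiv 0\pmod 3$.
   Context: For $r>2$, the generalised dodecahedron $D_r$ is the graph with vertex set $\{u_0,\dots,u_{r-1},v_0,\dots,v_{r-1},u'_0,\dots,u'_{r-1},v'_0,\dots,v'_{r-1}\}$ and edge set $\{u_iu_{i+1},\ v_iv_{i+1},\ u_iu'_i,\ v_iv'_i,\ v'_iu'_i,\ u'_iv'_{i+1}: 0\le i\le r-1\}$, indices taken modulo $r$. An injective $k$-colouring of a graph $G$ is a map $c:V(G)\to\{1,\dots,k\}$ such that any two distinct vertices with a common neighbour get different colours; the injective chromatic number $\chi_i(G)$ is the least such $k$. -}

module Defs where

open import Data.Nat using (ℕ; zero; suc; _<_; NonZero)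
open import Data.Nat.DivMod using (_%_; m%n<n)
open import Data.Fin using (Fin; toℕ; fromℕ<)
open import Data.Product using (_×_; ∃)
open import Data.Sum using (_⊎_)
open import Data.Empty using (⊥)
open import Relation.Binary.PropositionalEquality using (_≡_; _≢_)

data Kind : Set where
  u v u' v' : Kind

record Vtx (r : ℕ) : Set where
  constructor ⟨_,_⟩
  field
    kind : Kind
    idx  : Fin r

sucMod : (r : ℕ) .{{_ : NonZero r}} → Fin r → Fin r
sucMod r i = fromℕ< (m%n<n (suc (toℕ i)) r)

data Edge (r : ℕ) .{{_ : NonZero r}} : Vtx r → Vtx r → Set where
  uu   : (i : Fin r) → Edge r ⟨ u  , i ⟩ ⟨ u  , sucMod r i ⟩
  vv   : (i : Fin r) → Edge r ⟨ v  , i ⟩ ⟨ v  , sucMod r i ⟩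
  uu'  : (i : Fin r) → Edge r ⟨ u  , i ⟩ ⟨ u' , i ⟩
  vv'  : (i : Fin r) → Edge r ⟨ v  , i ⟩ ⟨ v' , i ⟩
  v'u' : (i : Fin r) → Edge r ⟨ v' , i ⟩ ⟨ u' , i ⟩
  u'v' : (i : Fin r) → Edge r ⟨ u' , i ⟩ ⟨ v' , sucMod r i ⟩

Adj : (r : ℕ) .{{_ : NonZero r}} → Vtx r → Vtx r → Set
Adj r x y = Edge r x y ⊎ Edge r y x

IsInjectiveColouring : (r : ℕ) .{{_ : NonZero r}} (k : ℕ) → (Vtx r → Fin k) → Set
IsInjectiveColouring r k c =
  (x y : Vtx r) → x ≢ y → (∃ λ w → Adj r x w × Adj r y w) → c x ≢ c y

HasInjectiveColouring : (r : ℕ) .{{_ : NonZero r}} (k : ℕ) → Set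
HasInjectiveColouring r k = ∃ λ (c : Vtx r → Fin k) → IsInjectiveColouring r k c

InjChromaticNumberIs : (r : ℕ) .{{_ : NonZero r}} (n : ℕ) → Set
InjChromaticNumberIs r n =
  HasInjectiveColouring r n × ((k : ℕ) → k < n → HasInjectiveColouring r k → ⊥)

{-# OPTIONS --safe #-}

-- D_r is cubic, so a colouring is injective exactly when every neighbourhood is rainbow; in
-- particular at least three colours are needed. With three colours every neighbourhood uses each
-- colour once, which forces consecutive vertices of the u-cycle to differ; any three consecutive
-- u_i then carry all three colours, so the colours along the u-cycle have period 3 and 3 ∣ r.
-- Conversely, a colouring of D_r is a cyclic word of columns (the colours of u_i, v_i, u'_i, v'_i)
-- whose consecutive triples are compatible, i.e. a closed walk of length r in a digraph of
-- columns. A 3-cycle a → b → c → a of three-coloured columns handles 3 ∣ r, and two detours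
-- a → b → d → f → a and a → b → c → e → f → a through a fourth colour give closed walks of every
-- length 4 + 3q and 5 + 3q.

module Submission where

open import Defs
open import Data.Empty using (⊥)
open import Data.Fin using (Fin; toℕ; _≟_)
open import Data.Fin.Patterns using (0F; 1F; 2F; 3F)
open import Data.Fin.Properties using (toℕ-fromℕ<; toℕ-injective; toℕ<n; injective⇒≤; all?)
open import Data.Nat
  using (ℕ; zero; suc; pred; _+_; _*_; _<_; _≤_; _%_; _/_; NonZero; z≤n; s≤s)
open import Data.Nat.DivMod
  using (_mod_; m%n<n; m%n%n≡m%n; %-distribˡ-+; %-remove-+ˡ; [m+n]%n≡m%n; [m+kn]%n≡m%n;
         m<n⇒m%n≡m; n%n≡0; m≡m%n+[m/n]*n)
open import Data.Nat.Divisibility using (divides; ∣⇒≤; ∣-refl)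
open import Data.Nat.Properties
  using (+-assoc; +-comm; +-cancelʳ-≡; suc-pred; <⇒≱; <⇒≤; ≤-refl; ≤-trans; m≤m+n; m≤n⇒m<n∨m≡n)
open import Data.Product using (_×_; _,_; ∃; proj₁; proj₂)
open import Data.Sum using (inj₁; inj₂)
open import Data.Vec.Functional using (Vector; []; _∷_)
open import Function.Base using (_∘_)
open import Function.Bundles using (_⇔_; mk⇔)
open import Function.Definitions using (Injective)
open import Relation.Binary.PropositionalEquality
open import Relation.Nullary using (Dec; ¬?; _×-dec_; _→-dec_; contradiction)
open import Relation.Nullary.Decidable using (From-yes; from-yes)

Rainbow : {A : Set} → Vector A 3 → Set
Rainbow f = f 0F ≢ f 1F × f 0F ≢ f 2F × f 1F ≢ f 2F

rainbow⇒injective : {A : Set} {f : Vector A 3} → Rainbow f → Injective _≡_ _≡_ f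
rainbow⇒injective _           {0F} {0F} _ = refl
rainbow⇒injective (h , _ , _) {0F} {1F} e = contradiction e h
rainbow⇒injective (_ , h , _) {0F} {2F} e = contradiction e h
rainbow⇒injective (h , _ , _) {1F} {0F} e = contradiction (sym e) h
rainbow⇒injective _           {1F} {1F} _ = refl
rainbow⇒injective (_ , _ , h) {1F} {2F} e = contradiction e h
rainbow⇒injective (_ , h , _) {2F} {0F} e = contradiction (sym e) h
rainbow⇒injective (_ , _ , h) {2F} {1F} e = contradiction (sym e) h
rainbow⇒injective _           {2F} {2F} _ = refl

rainbow? : ∀ {k} (f : Vector (Fin k) 3) → Dec (Rainbow f)
rainbow? f = ¬? (f 0F ≟ f 1F) ×-dec ¬? (f 0F ≟ f 2F) ×-dec ¬? (f 1F ≟ f 2F)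

third-unique : (a b x y : Fin 3) → a ≢ b → x ≢ a → x ≢ b → y ≢ a → y ≢ b → x ≡ y
third-unique = from-yes (all? λ (a : Fin 3) → all? λ b → all? λ x → all? λ y →
  ¬? (a ≟ b) →-dec ¬? (x ≟ a) →-dec ¬? (x ≟ b) →-dec ¬? (y ≟ a) →-dec ¬? (y ≟ b) →-dec x ≟ y)

[k+m%n]%n≡[k+m]%n : ∀ k m n .{{_ : NonZero n}} → (k + m % n) % n ≡ (k + m) % n
[k+m%n]%n≡[k+m]%n k m n = begin
  (k + m % n) % n           ≡⟨ %-distribˡ-+ k (m % n) n ⟩
  (k % n + m % n % n) % n   ≡⟨ cong (λ x → (k % n + x) % n) (m%n%n≡m%n m n) ⟩
  (k % n + m % n) % n       ≡⟨ %-distribˡ-+ k m n ⟨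
  (k + m) % n               ∎
  where open ≡-Reasoning

module _ {r : ℕ} .{{_ : NonZero r}} where

  toℕ-mod : ∀ n → toℕ (n mod r) ≡ n % r
  toℕ-mod n = toℕ-fromℕ< (m%n<n n r)

  mod-cong : ∀ {m n} → m % r ≡ n % r → m mod r ≡ n mod r
  mod-cong {m} {n} eq = toℕ-injective (trans (toℕ-mod m) (trans eq (sym (toℕ-mod n))))

  shift : ℕ → Fin r → Fin r
  shift k i = (k + toℕ i) mod r

  next : Fin r → Fin r
  next = sucMod r

  prev : Fin r → Fin r
  prev = shift (pred r)

  shift-shift : ∀ k l i → shift k (shift l i) ≡ shift (k + l) i
  shift-shift k l i = mod-cong (begin
    (k + toℕ (shift l i)) % r   ≡⟨ cong (λ x → (k + x) % r) (toℕ-mod (l + toℕ i)) ⟩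
    (k + (l + toℕ i) % r) % r   ≡⟨ [k+m%n]%n≡[k+m]%n k (l + toℕ i) r ⟩
    (k + (l + toℕ i)) % r       ≡⟨ cong (_% r) (+-assoc k l (toℕ i)) ⟨
    (k + l + toℕ i) % r         ∎)
    where open ≡-Reasoning

  shift-r : ∀ i → shift r i ≡ i
  shift-r i = toℕ-injective (begin
    toℕ (shift r i)     ≡⟨ toℕ-mod (r + toℕ i) ⟩
    (r + toℕ i) % r     ≡⟨ %-remove-+ˡ (toℕ i) ∣-refl ⟩
    toℕ i % r           ≡⟨ m<n⇒m%n≡m (toℕ<n i) ⟩
    toℕ i               ∎)
    where open ≡-Reasoning

  -- (k + i) % r ≡ i forces r ∣ k
  shift-≢ : ∀ {k} i → 0 < k → k < r → shift k i ≢ i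
  shift-≢ {suc k} i _ k<r eq = <⇒≱ k<r (∣⇒≤ (divides q (+-cancelʳ-≡ t (suc k) (q * r) k+t≡q*r+t)))
    where
    t = toℕ i
    q = (suc k + t) / r
    k+t≡q*r+t : suc k + t ≡ q * r + t
    k+t≡q*r+t = begin
      suc k + t                   ≡⟨ m≡m%n+[m/n]*n (suc k + t) r ⟩
      (suc k + t) % r + q * r     ≡⟨ cong (_+ q * r) (trans (sym (toℕ-mod (suc k + t))) (cong toℕ eq)) ⟩
      t + q * r                   ≡⟨ +-comm t (q * r) ⟩
      q * r + t                   ∎
      where open ≡-Reasoning

  next-prev : ∀ i → next (prev i) ≡ i
  next-prev i = begin
    shift 1 (shift (pred r) i)  ≡⟨ shift-shift 1 (pred r) i ⟩
    shift (suc (pred r)) i      ≡⟨ cong (λ k → shift k i) (suc-pred r) ⟩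
    shift r i                   ≡⟨ shift-r i ⟩
    i                           ∎
    where open ≡-Reasoning

  prev-next : ∀ i → prev (next i) ≡ i
  prev-next i = begin
    shift (pred r) (shift 1 i)  ≡⟨ shift-shift (pred r) 1 i ⟩
    shift (pred r + 1) i        ≡⟨ cong (λ k → shift k i) (trans (+-comm (pred r) 1) (suc-pred r)) ⟩
    shift r i                   ≡⟨ shift-r i ⟩
    i                           ∎
    where open ≡-Reasoning

  next≢id : 2 ≤ r → ∀ i → next i ≢ i
  next≢id 2≤r i = shift-≢ i (s≤s z≤n) 2≤r

  next²≢id : 3 ≤ r → ∀ i → next (next i) ≢ i
  next²≢id 3≤r i eq = shift-≢ i (s≤s z≤n) 3≤r (trans (sym (shift-shift 1 1 i)) eq)

  prev≢next : 3 ≤ r → ∀ i → prev i ≢ next i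
  prev≢next 3≤r i eq = next²≢id 3≤r i (trans (cong next (sym eq)) (next-prev i))

  prev≢id : 2 ≤ r → ∀ i → prev i ≢ i
  prev≢id 2≤r i eq = next≢id 2≤r i (trans (cong next (sym eq)) (next-prev i))

  next-mod : ∀ n → next (n mod r) ≡ suc n mod r
  next-mod n = mod-cong (trans (cong (λ x → suc x % r) (toℕ-mod n)) ([k+m%n]%n≡[k+m]%n 1 n r))

  mod-self : r mod r ≡ 0 mod r
  mod-self = mod-cong ([m+n]%n≡m%n 0 r)

module _ {r : ℕ} .{{_ : NonZero r}} where

  neighbours : Vtx r → Vector (Vtx r) 3
  neighbours ⟨ u  , i ⟩ = ⟨ u , prev i ⟩ ∷ ⟨ u  , next i ⟩ ∷ ⟨ u' , i ⟩ ∷ []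
  neighbours ⟨ v  , i ⟩ = ⟨ v , prev i ⟩ ∷ ⟨ v  , next i ⟩ ∷ ⟨ v' , i ⟩ ∷ []
  neighbours ⟨ u' , i ⟩ = ⟨ u , i ⟩      ∷ ⟨ v' , i ⟩      ∷ ⟨ v' , next i ⟩ ∷ []
  neighbours ⟨ v' , i ⟩ = ⟨ v , i ⟩      ∷ ⟨ u' , i ⟩      ∷ ⟨ u' , prev i ⟩ ∷ []

  adj⇒∈neighbours : ∀ {x w} → Adj r x w → ∃ λ j → neighbours w j ≡ x
  adj⇒∈neighbours (inj₁ (uu i))   = 0F , cong ⟨ u ,_⟩ (prev-next i)
  adj⇒∈neighbours (inj₁ (vv i))   = 0F , cong ⟨ v ,_⟩ (prev-next i)
  adj⇒∈neighbours (inj₁ (uu' i))  = 0F , refl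
  adj⇒∈neighbours (inj₁ (vv' i))  = 0F , refl
  adj⇒∈neighbours (inj₁ (v'u' i)) = 1F , refl
  adj⇒∈neighbours (inj₁ (u'v' i)) = 2F , cong ⟨ u' ,_⟩ (prev-next i)
  adj⇒∈neighbours (inj₂ (uu i))   = 1F , refl
  adj⇒∈neighbours (inj₂ (vv i))   = 1F , refl
  adj⇒∈neighbours (inj₂ (uu' i))  = 2F , refl
  adj⇒∈neighbours (inj₂ (vv' i))  = 2F , refl
  adj⇒∈neighbours (inj₂ (v'u' i)) = 1F , refl
  adj⇒∈neighbours (inj₂ (u'v' i)) = 2F , refl

  neighbours-adj : ∀ w j → Adj r (neighbours w j) w
  neighbours-adj ⟨ u  , i ⟩ 0F = subst (Adj r ⟨ u , prev i ⟩ ∘ ⟨ u ,_⟩) (next-prev i) (inj₁ (uu (prev i)))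
  neighbours-adj ⟨ u  , i ⟩ 1F = inj₂ (uu i)
  neighbours-adj ⟨ u  , i ⟩ 2F = inj₂ (uu' i)
  neighbours-adj ⟨ v  , i ⟩ 0F = subst (Adj r ⟨ v , prev i ⟩ ∘ ⟨ v ,_⟩) (next-prev i) (inj₁ (vv (prev i)))
  neighbours-adj ⟨ v  , i ⟩ 1F = inj₂ (vv i)
  neighbours-adj ⟨ v  , i ⟩ 2F = inj₂ (vv' i)
  neighbours-adj ⟨ u' , i ⟩ 0F = inj₁ (uu' i)
  neighbours-adj ⟨ u' , i ⟩ 1F = inj₁ (v'u' i)
  neighbours-adj ⟨ u' , i ⟩ 2F = inj₂ (u'v' i)
  neighbours-adj ⟨ v' , i ⟩ 0F = inj₁ (vv' i)
  neighbours-adj ⟨ v' , i ⟩ 1F = inj₂ (v'u' i)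
  neighbours-adj ⟨ v' , i ⟩ 2F = subst (Adj r ⟨ u' , prev i ⟩ ∘ ⟨ v' ,_⟩) (next-prev i) (inj₁ (u'v' (prev i)))

  neighbours-rainbow : 3 ≤ r → ∀ w → Rainbow (neighbours w)
  neighbours-rainbow 3≤r ⟨ u  , i ⟩ = prev≢next 3≤r i ∘ cong Vtx.idx , (λ ()) , (λ ())
  neighbours-rainbow 3≤r ⟨ v  , i ⟩ = prev≢next 3≤r i ∘ cong Vtx.idx , (λ ()) , (λ ())
  neighbours-rainbow 3≤r ⟨ u' , i ⟩ = (λ ()) , (λ ()) , next≢id (<⇒≤ 3≤r) i ∘ sym ∘ cong Vtx.idx
  neighbours-rainbow 3≤r ⟨ v' , i ⟩ = (λ ()) , (λ ()) , prev≢id (<⇒≤ 3≤r) i ∘ sym ∘ cong Vtx.idx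

  rainbow⇒isInjectiveColouring : ∀ {k} (c : Vtx r → Fin k) →
    (∀ w → Rainbow (c ∘ neighbours w)) → IsInjectiveColouring r k c
  rainbow⇒isInjectiveColouring c rainbow x y x≢y (w , x~w , y~w)
    with adj⇒∈neighbours x~w | adj⇒∈neighbours y~w
  ... | i , refl | j , refl = x≢y ∘ cong (neighbours w) ∘ rainbow⇒injective (rainbow w)

  isInjectiveColouring⇒rainbow : ∀ {k} {c : Vtx r → Fin k} → 3 ≤ r →
    IsInjectiveColouring r k c → ∀ w → Rainbow (c ∘ neighbours w)
  isInjectiveColouring⇒rainbow {c = c} 3≤r injective w with neighbours-rainbow 3≤r w
  ... | n₀≢n₁ , n₀≢n₂ , n₁≢n₂ = apart n₀≢n₁ , apart n₀≢n₂ , apart n₁≢n₂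
    where
    apart : ∀ {i j} → neighbours w i ≢ neighbours w j → c (neighbours w i) ≢ c (neighbours w j)
    apart ne = injective _ _ ne (w , neighbours-adj w _ , neighbours-adj w _)

hasInjectiveColouring⇒3≤k : ∀ {r k} .{{_ : NonZero r}} → 3 ≤ r → HasInjectiveColouring r k → 3 ≤ k
hasInjectiveColouring⇒3≤k {r} 3≤r (c , injective) =
  injective⇒≤ (rainbow⇒injective {f = c ∘ neighbours ⟨ u' , 0 mod r ⟩}
    (isInjectiveColouring⇒rainbow {c = c} 3≤r injective ⟨ u' , 0 mod r ⟩))

module _ {b : ℕ → Fin 3} (b-step : ∀ n → b n ≢ b (1 + n)) (b-gap : ∀ n → b n ≢ b (2 + n)) where

  period-3 : ∀ n → b (3 + n) ≡ b n
  period-3 n = third-unique (b (1 + n)) (b (2 + n)) (b (3 + n)) (b n)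
    (b-step (1 + n)) (≢-sym (b-gap (1 + n))) (≢-sym (b-step (2 + n))) (b-step n) (b-gap n)

  ≡-mod-3 : ∀ n → b n ≡ b (n % 3)
  ≡-mod-3 0                   = refl
  ≡-mod-3 1                   = refl
  ≡-mod-3 2                   = refl
  ≡-mod-3 (suc (suc (suc n))) = trans (period-3 n) (≡-mod-3 n)

  return⇒%3≡0 : ∀ n → b n ≡ b 0 → n % 3 ≡ 0
  return⇒%3≡0 n bn≡b0 = residue (n % 3) (m%n<n n 3) (trans (sym (≡-mod-3 n)) bn≡b0)
    where
    residue : ∀ t → t < 3 → b t ≡ b 0 → t ≡ 0
    residue 0 _ _ = refl
    residue 1 _ e = contradiction (sym e) (b-step 0)
    residue 2 _ e = contradiction (sym e) (b-gap 0)
    residue (suc (suc (suc _))) (s≤s (s≤s (s≤s ()))) _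

-- uᵢ, vᵢ, u'ᵢ, v'ᵢ stand for the colours of u_{x+i}, v_{x+i}, u'_{x+i}, v'_{x+i}; the hypotheses are
-- the neighbourhoods of u_{x+1}, u'_x, u'_{x+1}, v_x, v_{x+2}, v'_{x+1}. With three colours a repeat
-- u₁ = u₂ forces v'₂ = u₀ and v'₀ = u₁, which leaves v₁ no colour but u'₁.
no-repeat : {u₀ u₁ u₂ v₁ u'₁ v'₀ v'₁ v'₂ : Fin 3} →
  Rainbow (u₀ ∷ u₂ ∷ u'₁ ∷ []) → Rainbow (u₀ ∷ v'₀ ∷ v'₁ ∷ []) → Rainbow (u₁ ∷ v'₁ ∷ v'₂ ∷ []) →
  v₁ ≢ v'₀ → v₁ ≢ v'₂ → v₁ ≢ u'₁ → u₁ ≢ u₂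
no-repeat {u₀} {u₁} {_} {v₁} {u'₁} {v'₀} {v'₁} {v'₂}
  (u₀≢u₁ , u₀≢u'₁ , u₁≢u'₁) (u₀≢v'₀ , u₀≢v'₁ , v'₀≢v'₁) (u₁≢v'₁ , u₁≢v'₂ , v'₁≢v'₂)
  v₁≢v'₀ v₁≢v'₂ v₁≢u'₁ refl = v₁≢u'₁ v₁≡u'₁
  where
  v'₂≡u₀ : v'₂ ≡ u₀
  v'₂≡u₀ = third-unique u₁ v'₁ v'₂ u₀ u₁≢v'₁ (≢-sym u₁≢v'₂) (≢-sym v'₁≢v'₂) u₀≢u₁ u₀≢v'₁
  v'₀≡u₁ : v'₀ ≡ u₁
  v'₀≡u₁ = third-unique u₀ v'₁ v'₀ u₁ u₀≢v'₁ (≢-sym u₀≢v'₀) v'₀≢v'₁ (≢-sym u₀≢u₁) u₁≢v'₁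
  v₁≡u'₁ : v₁ ≡ u'₁
  v₁≡u'₁ = third-unique u₀ u₁ v₁ u'₁ u₀≢u₁ (subst (v₁ ≢_) v'₂≡u₀ v₁≢v'₂) (subst (v₁ ≢_) v'₀≡u₁ v₁≢v'₀)
             (≢-sym u₀≢u'₁) (≢-sym u₁≢u'₁)

module _ {r : ℕ} .{{_ : NonZero r}} (c : Vtx r → Fin 3) (rainbow : ∀ w → Rainbow (c ∘ neighbours w)) where

  private
    around-u : ∀ x → Rainbow (c ⟨ u , x ⟩ ∷ c ⟨ u , next (next x) ⟩ ∷ c ⟨ u' , next x ⟩ ∷ [])
    around-u x = subst (λ y → Rainbow (c ⟨ u , y ⟩ ∷ c ⟨ u , next (next x) ⟩ ∷ c ⟨ u' , next x ⟩ ∷ []))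
                       (prev-next x) (rainbow ⟨ u , next x ⟩)

  u-adjacent-colours-differ : ∀ x → c ⟨ u , next x ⟩ ≢ c ⟨ u , next (next x) ⟩
  u-adjacent-colours-differ x = no-repeat (around-u x) (rainbow ⟨ u' , x ⟩) (rainbow ⟨ u' , next x ⟩)
    (proj₂ (proj₂ (rainbow ⟨ v , x ⟩))) v₁≢v'₂ (proj₁ (rainbow ⟨ v' , next x ⟩))
    where
    v₁≢v'₂ : c ⟨ v , next x ⟩ ≢ c ⟨ v' , next (next x) ⟩
    v₁≢v'₂ = subst (λ y → c ⟨ v , y ⟩ ≢ c ⟨ v' , next (next x) ⟩) (prev-next (next x))
                   (proj₁ (proj₂ (rainbow ⟨ v , next (next x) ⟩)))

  u-colours : ℕ → Fin 3
  u-colours n = c ⟨ u , next (n mod r) ⟩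

  u-colours-step : ∀ n → u-colours n ≢ u-colours (1 + n)
  u-colours-step n rewrite sym (next-mod n) = u-adjacent-colours-differ (n mod r)

  u-colours-gap : ∀ n → u-colours n ≢ u-colours (2 + n)
  u-colours-gap n rewrite sym (next-mod (suc n)) | sym (next-mod n) = proj₁ (around-u (next (n mod r)))

  u-colours-cyclic : u-colours r ≡ u-colours 0
  u-colours-cyclic = cong (λ i → c ⟨ u , next i ⟩) mod-self

hasInjectiveColouring-3⇒r%3≡0 : ∀ {r} .{{_ : NonZero r}} → 3 ≤ r → HasInjectiveColouring r 3 → r % 3 ≡ 0
hasInjectiveColouring-3⇒r%3≡0 {r} 3≤r (c , injective) =
  return⇒%3≡0 (u-colours-step c rainbow) (u-colours-gap c rainbow) r (u-colours-cyclic c rainbow)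
  where
  rainbow : ∀ w → Rainbow (c ∘ neighbours w)
  rainbow = isInjectiveColouring⇒rainbow {c = c} 3≤r injective

Column : ℕ → Set
Column k = Kind → Fin k

column : ∀ {k} → Fin k → Fin k → Fin k → Fin k → Column k
column x _ _ _ u  = x
column _ x _ _ v  = x
column _ _ x _ u' = x
column _ _ _ x v' = x

-- The neighbourhoods of u_i, v_i, u'_i, v'_i when a, b, d are the columns at i - 1, i, i + 1.
Window : ∀ {k} → Column k → Column k → Column k → Set
Window a b d = Rainbow (a u ∷ d u ∷ b u' ∷ []) × Rainbow (a v ∷ d v ∷ b v' ∷ [])
             × Rainbow (b u ∷ b v' ∷ d v' ∷ []) × Rainbow (b v ∷ b u' ∷ a u' ∷ [])

window? : ∀ {k} (a b d : Column k) → Dec (Window a b d)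
window? a b d = rainbow? (a u ∷ d u ∷ b u' ∷ []) ×-dec rainbow? (a v ∷ d v ∷ b v' ∷ [])
         ×-dec rainbow? (b u ∷ b v' ∷ d v' ∷ []) ×-dec rainbow? (b v ∷ b u' ∷ a u' ∷ [])

module _ {St : Set} {k : ℕ} (palette : St → Column k) (Step : St → St → Set)
         (step-window : ∀ {x y z} → Step x y → Step y z → Window (palette x) (palette y) (palette z))
         where

  closedWalk⇒hasInjectiveColouring : ∀ {r} .{{_ : NonZero r}} (w : Fin r → St) →
    (∀ i → Step (w i) (w (next i))) → HasInjectiveColouring r k
  closedWalk⇒hasInjectiveColouring {r} w steps = colour , rainbow⇒isInjectiveColouring colour rainbow
    where
    colour : Vtx r → Fin k
    colour x = palette (w (Vtx.idx x)) (Vtx.kind x)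
    window : ∀ i → Window (palette (w (prev i))) (palette (w i)) (palette (w (next i)))
    window i = step-window (subst (Step (w (prev i)) ∘ w) (next-prev i) (steps (prev i))) (steps i)
    rainbow : ∀ x → Rainbow (colour ∘ neighbours x)
    rainbow ⟨ u  , i ⟩ = proj₁ (window i)
    rainbow ⟨ v  , i ⟩ = proj₁ (proj₂ (window i))
    rainbow ⟨ u' , i ⟩ = proj₁ (proj₂ (proj₂ (window i)))
    rainbow ⟨ v' , i ⟩ = proj₂ (proj₂ (proj₂ (window i)))

cyclic-steps : ∀ {A : Set} {R : A → A → Set} {r} .{{_ : NonZero r}} (w : ℕ → A) →
  (∀ n → R (w n) (w (suc n))) → R (w (pred r)) (w 0) → ∀ (i : Fin r) → R (w (toℕ i)) (w (toℕ (next i)))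
cyclic-steps {R = R} {r} w steps wrap i with m≤n⇒m<n∨m≡n (toℕ<n i)
... | inj₁ 1+i<r = subst (R (w (toℕ i)) ∘ w) (sym (trans (toℕ-mod (suc (toℕ i))) (m<n⇒m%n≡m 1+i<r)))
                         (steps (toℕ i))
... | inj₂ 1+i≡r = subst₂ (λ m n → R (w m) (w n)) (cong pred (sym 1+i≡r))
                          (sym (trans (toℕ-mod (suc (toℕ i))) (trans (cong (_% r) 1+i≡r) (n%n≡0 r))))
                          wrap

cycle₃ : {A : Set} → A → A → A → ℕ → A
cycle₃ x y z 0                   = x
cycle₃ x y z 1                   = y
cycle₃ x y z 2                   = z
cycle₃ x y z (suc (suc (suc n))) = cycle₃ x y z n

cycle₃-steps : ∀ {A : Set} {R : A → A → Set} {x y z} → R x y → R y z → R z x →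
  ∀ n → R (cycle₃ x y z n) (cycle₃ x y z (suc n))
cycle₃-steps         xy yz zx 0                   = xy
cycle₃-steps         xy yz zx 1                   = yz
cycle₃-steps         xy yz zx 2                   = zx
cycle₃-steps {R = R} xy yz zx (suc (suc (suc n))) = cycle₃-steps {R = R} xy yz zx n

cycle₃-1+q*3 : ∀ {A : Set} {x y z : A} q → cycle₃ x y z (1 + q * 3) ≡ y
cycle₃-1+q*3 zero    = refl
cycle₃-1+q*3 (suc q) = cycle₃-1+q*3 q

module ThreeColouring where

  data State : Set where
    a b c : State

  data Step : State → State → Set where
    a→b : Step a b
    b→c : Step b c
    c→a : Step c a

  palette : State → Column 3
  palette a = column 0F 1F 0F 1F
  palette b = column 1F 2F 1F 2F
  palette c = column 2F 0F 2F 0F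

  checked : ∀ x y z → From-yes (window? (palette x) (palette y) (palette z))
  checked x y z = from-yes (window? (palette x) (palette y) (palette z))

  step-window : ∀ {x y z} → Step x y → Step y z → Window (palette x) (palette y) (palette z)
  step-window a→b b→c = checked a b c
  step-window b→c c→a = checked b c a
  step-window c→a a→b = checked c a b

  walk : ℕ → State
  walk 0       = c
  walk (suc n) = cycle₃ a b c n

  walk-steps : ∀ n → Step (walk n) (walk (suc n))
  walk-steps 0       = c→a
  walk-steps (suc n) = cycle₃-steps {R = Step} a→b b→c c→a n

  hasInjectiveColouring-3+q*3 : ∀ q → HasInjectiveColouring (3 + q * 3) 3
  hasInjectiveColouring-3+q*3 q = closedWalk⇒hasInjectiveColouring palette Step step-window (walk ∘ toℕ)
    (cyclic-steps {R = Step} walk walk-steps (subst (λ x → Step x c) (sym (cycle₃-1+q*3 q)) b→c))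

module FourColouring where

  data State : Set where
    a b c d e f : State

  data Step : State → State → Set where
    a→b : Step a b
    b→c : Step b c
    c→a : Step c a
    b→d : Step b d
    d→f : Step d f
    f→a : Step f a
    c→e : Step c e
    e→f : Step e f

  palette : State → Column 4
  palette a = column 0F 1F 0F 1F
  palette b = column 1F 2F 1F 2F
  palette c = column 2F 0F 2F 0F
  palette d = column 3F 3F 0F 0F
  palette e = column 3F 3F 0F 1F
  palette f = column 3F 3F 2F 2F

  checked : ∀ x y z → From-yes (window? (palette x) (palette y) (palette z))
  checked x y z = from-yes (window? (palette x) (palette y) (palette z))

  step-window : ∀ {x y z} → Step x y → Step y z → Window (palette x) (palette y) (palette z)
  step-window a→b b→c = checked a b c
  step-window a→b b→d = checked a b d
  step-window b→c c→a = checked b c a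
  step-window b→c c→e = checked b c e
  step-window c→a a→b = checked c a b
  step-window b→d d→f = checked b d f
  step-window d→f f→a = checked d f a
  step-window f→a a→b = checked f a b
  step-window c→e e→f = checked c e f
  step-window e→f f→a = checked e f a

  walk₄ : ℕ → State
  walk₄ 0             = d
  walk₄ 1             = f
  walk₄ (suc (suc n)) = cycle₃ a b c n

  walk₄-steps : ∀ n → Step (walk₄ n) (walk₄ (suc n))
  walk₄-steps 0             = d→f
  walk₄-steps 1             = f→a
  walk₄-steps (suc (suc n)) = cycle₃-steps {R = Step} a→b b→c c→a n

  walk₅ : ℕ → State
  walk₅ 0                   = c
  walk₅ 1                   = e
  walk₅ 2                   = f
  walk₅ (suc (suc (suc n))) = cycle₃ a b c n

  walk₅-steps : ∀ n → Step (walk₅ n) (walk₅ (suc n))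
  walk₅-steps 0                   = c→e
  walk₅-steps 1                   = e→f
  walk₅-steps 2                   = f→a
  walk₅-steps (suc (suc (suc n))) = cycle₃-steps {R = Step} a→b b→c c→a n

  hasInjectiveColouring-4+q*3 : ∀ q → HasInjectiveColouring (4 + q * 3) 4
  hasInjectiveColouring-4+q*3 q = closedWalk⇒hasInjectiveColouring palette Step step-window (walk₄ ∘ toℕ)
    (cyclic-steps {R = Step} walk₄ walk₄-steps (subst (λ x → Step x d) (sym (cycle₃-1+q*3 q)) b→d))

  hasInjectiveColouring-5+q*3 : ∀ q → HasInjectiveColouring (5 + q * 3) 4
  hasInjectiveColouring-5+q*3 q = closedWalk⇒hasInjectiveColouring palette Step step-window (walk₅ ∘ toℕ)
    (cyclic-steps {R = Step} walk₅ walk₅-steps (subst (λ x → Step x c) (sym (cycle₃-1+q*3 q)) b→c))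

data Mod3 : ℕ → Set where
  3+q*3 : ∀ q → Mod3 (3 + q * 3)
  4+q*3 : ∀ q → Mod3 (4 + q * 3)
  5+q*3 : ∀ q → Mod3 (5 + q * 3)

mod3 : ∀ n → Mod3 (3 + n)
mod3 0 = 3+q*3 0
mod3 1 = 4+q*3 0
mod3 2 = 5+q*3 0
mod3 (suc (suc (suc n))) with mod3 n
... | 3+q*3 q = 3+q*3 (suc q)
... | 4+q*3 q = 4+q*3 (suc q)
... | 5+q*3 q = 5+q*3 (suc q)

hasInjectiveColouring-3 : ∀ r .{{_ : NonZero r}} → 3 ≤ r → r % 3 ≡ 0 → HasInjectiveColouring r 3
hasInjectiveColouring-3 _ (s≤s (s≤s (s≤s {n = n} _))) r%3≡0 with mod3 n
... | 3+q*3 q = ThreeColouring.hasInjectiveColouring-3+q*3 q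
... | 4+q*3 q = contradiction (trans (sym ([m+kn]%n≡m%n 4 q 3)) r%3≡0) λ ()
... | 5+q*3 q = contradiction (trans (sym ([m+kn]%n≡m%n 5 q 3)) r%3≡0) λ ()

hasInjectiveColouring-4 : ∀ r .{{_ : NonZero r}} → 3 ≤ r → r % 3 ≢ 0 → HasInjectiveColouring r 4
hasInjectiveColouring-4 _ (s≤s (s≤s (s≤s {n = n} _))) r%3≢0 with mod3 n
... | 3+q*3 q = contradiction ([m+kn]%n≡m%n 3 q 3) r%3≢0
... | 4+q*3 q = FourColouring.hasInjectiveColouring-4+q*3 q
... | 5+q*3 q = FourColouring.hasInjectiveColouring-5+q*3 q

theorem19 : (r : ℕ) .{{_ : NonZero r}} → 5 ≤ r →
    InjChromaticNumberIs r 4 ⇔ (r % 3 ≢ 0)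
theorem19 r 5≤r = mk⇔
  (λ (_ , minimal) r%3≡0 → minimal 3 ≤-refl (hasInjectiveColouring-3 r 3≤r r%3≡0))
  (λ r%3≢0 → hasInjectiveColouring-4 r 3≤r r%3≢0 , fewer r%3≢0)
  where
  3≤r : 3 ≤ r
  3≤r = ≤-trans (m≤m+n 3 2) 5≤r
  fewer : r % 3 ≢ 0 → ∀ k → k < 4 → HasInjectiveColouring r k → ⊥
  fewer r%3≢0 k (s≤s k≤3) colouring with m≤n⇒m<n∨m≡n k≤3
  ... | inj₁ k<3  = <⇒≱ k<3 (hasInjectiveColouring⇒3≤k 3≤r colouring)
  ... | inj₂ refl = r%3≢0 (hasInjectiveColouring-3⇒r%3≡0 3≤r colouring)
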